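{- Let $(X,\leq_1,\leq_2,R)$ be a modal FM frame. For every $Y\in\mathsf{RO}_{12}(X)$, $$Y=\bigvee_{\mathsf{RO}_{12}}\{c(\{x\})\mid x\in Y\}=\bigvee_{\mathsf{RO}_{12}}\{Z\in\mathsf{Nom}(\mathbb{H}_{\mathsf{RO}_{12}})\mid Z\subseteq Y\}.$$
   Context: An FM frame is a triple $(X,\leq_1,\leq_2)$ where $\leq_1,\leq_2$ are partial orders on $X$ with $\leq_2\subseteq\leq_1$. For $Y\subseteq X$, $\mathsf{I}_1\mathsf{C}_2(Y)=\{w\in X\mid \forall v\geq_1 w\ \exists u\geq_2 v\ (u\in Y)\}$ (interior in the topology of $\leq_1$-upsets of the closure in the topology of $\leq_2$-upsets), and $\mathsf{RO}_{12}(X)=\{Y\subseteq X\mid Y=\mathsf{I}_1\mathsf{C}_2(Y)\}$. A modal FM frame is $(X,\leq_1,\leq_2,R)$ with $R\subseteq X\times X$ such that $\{w\mid R[w]\subseteq Y\}\in\mathsf{RO}_{12}(X)$ whenever $Y\in\mathsf{RO}_{12}(X)$. The set $\mathsf{RO}_{12}(X)$ ordered by inclusion is a complete lattice whose join of a family $\mathcal{S}$ is $\bigvee_{\mathsf{RO}_{12}}\mathcal{S}=\mathsf{I}_1\mathsf{C}_2(\bigcup\mathcal{S})$ and whose meets are intersections. For $a\subseteq X$, $c(a)=\bigcap\{b\in\mathsf{RO}_{12}(X)\mid a\subseteq b\}$ is the smallest refined regular open set containing $a$ (the left adjoint of the inclusion $\mathsf{RO}_{12}(X)\hookrightarrow\mathcal{P}(X)$).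 $\mathsf{Nom}(\mathbb{H}_{\mathsf{RO}_{12}}):=\{c(\{x\})\mid x\in X\}$. -}

module Defs where

open import Level using (Level; _⊔_; suc)
open import Data.Product using (Σ; ∃; _×_; _,_)
open import Relation.Binary.PropositionalEquality using (_≡_)
open import Relation.Binary.Core using (Rel)
open import Relation.Binary.Structures using (IsPartialOrder)

Subset : ∀ {a} (X : Set a) (ℓ : Level) → Set (a ⊔ suc ℓ)
Subset X ℓ = X → Set ℓ

_⊆_ : ∀ {a ℓ₁ ℓ₂} {X : Set a} → Subset X ℓ₁ → Subset X ℓ₂ → Set (a ⊔ ℓ₁ ⊔ ℓ₂)
A ⊆ B = ∀ w → A w → B w

_≐_ : ∀ {a ℓ₁ ℓ₂} {X : Set a} → Subset X ℓ₁ → Subset X ℓ₂ → Set (a ⊔ ℓ₁ ⊔ ℓ₂)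
A ≐ B = (A ⊆ B) × (B ⊆ A)

record FMFrame (ℓ : Level) : Set (suc ℓ) where
  field
    X   : Set ℓ
    _≤₁_ : Rel X ℓ
    _≤₂_ : Rel X ℓ
    isPO₁ : IsPartialOrder _≡_ _≤₁_
    isPO₂ : IsPartialOrder _≡_ _≤₂_
    ≤₂⊆≤₁ : ∀ {x y} → x ≤₂ y → x ≤₁ y

module _ {ℓ : Level} (F : FMFrame ℓ) where
  open FMFrame F

  I₁C₂ : ∀ {ℓ'} → Subset X ℓ' → Subset X (ℓ ⊔ ℓ')
  I₁C₂ Y w = ∀ v → w ≤₁ v → Σ X (λ u → (v ≤₂ u) × Y u)

  IsRO : ∀ {ℓ'} → Subset X ℓ' → Set (ℓ ⊔ ℓ')
  IsRO Y = Y ≐ I₁C₂ Y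

  box : ∀ {ℓ'} → Rel X ℓ → Subset X ℓ' → Subset X (ℓ ⊔ ℓ')
  box R Y w = ∀ v → R w v → Y v

  ⋃ : ∀ {i ℓ'} {I : Set i} → (I → Subset X ℓ') → Subset X (i ⊔ ℓ')
  ⋃ {I = I} G w = Σ I (λ j → G j w)

  ⋁RO : ∀ {i ℓ'} {I : Set i} → (I → Subset X ℓ') → Subset X (ℓ ⊔ i ⊔ ℓ')
  ⋁RO G = I₁C₂ (⋃ G)

  c : ∀ {ℓ'} → Subset X ℓ' → Subset X (suc ℓ ⊔ ℓ')
  c a x = (b : Subset X ℓ) → IsRO b → a ⊆ b → b x

  ⟦_⟧ : X → Subset X ℓ
  ⟦ x ⟧ w = w ≡ x

  InNom : ∀ {ℓ'} → Subset X ℓ' → Set (suc ℓ ⊔ ℓ')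
  InNom Z = Σ X (λ x → Z ≐ c ⟦ x ⟧)

record ModalFMFrame (ℓ : Level) : Set (suc ℓ) where
  field
    frame : FMFrame ℓ
  open FMFrame frame public
  field
    R : Rel X ℓ
    box-RO : (Y : Subset X ℓ) → IsRO frame Y → IsRO frame (box frame R Y)

{-# OPTIONS --safe #-}
module Submission where

-- Every x ∈ Y lies in c{x}, and c{x} ⊆ Y because Y is a refined regular open set
-- containing x. Hence Y is already the plain union of the c{x} (x ∈ Y), and equally of
-- the nominals contained in Y; applying I₁C₂, which fixes Y, turns either union into
-- the join in RO₁₂(X).

open import Defs
open import Level using (Level; suc)
open import Data.Product using (Σ; _×_; _,_; proj₁; proj₂)
open import Relation.Binary.PropositionalEquality using (refl; subst; sym)

module _ {ℓ : Level} (F : FMFrame ℓ) where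
  open FMFrame F using (X)

  I₁C₂-mono : ∀ {ℓ₁ ℓ₂} {A : Subset X ℓ₁} {B : Subset X ℓ₂} →
              A ⊆ B → I₁C₂ F A ⊆ I₁C₂ F B
  I₁C₂-mono A⊆B w wInt v w≤₁v with wInt v w≤₁v
  ... | u , v≤₂u , Au = u , v≤₂u , A⊆B u Au

  ⊆-c : ∀ {ℓ'} (a : Subset X ℓ') → a ⊆ c F a
  ⊆-c a w aw b _ a⊆b = a⊆b w aw

  c-least : ∀ {ℓ'} {a : Subset X ℓ'} {b : Subset X ℓ} → IsRO F b → a ⊆ b → c F a ⊆ b
  c-least {b = b} bRO a⊆b w caw = caw b bRO a⊆b

  c-singleton-⊆ : ∀ {Y : Subset X ℓ} {x : X} → IsRO F Y → Y x → c F (⟦_⟧ F x) ⊆ Y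
  c-singleton-⊆ {Y} YRO Yx = c-least YRO (λ w w≡x → subst Y (sym w≡x) Yx)

  ∈-c-singleton : ∀ x → c F (⟦_⟧ F x) x
  ∈-c-singleton x = ⊆-c (⟦_⟧ F x) x refl

  IsRO-≐-⋁RO : ∀ {i ℓ'} {I : Set i} {Y : Subset X ℓ} {G : I → Subset X ℓ'} →
               IsRO F Y → Y ≐ ⋃ F G → Y ≐ ⋁RO F G
  IsRO-≐-⋁RO (Y⊆IY , IY⊆Y) (Y⊆⋃G , ⋃G⊆Y) =
      (λ w Yw → I₁C₂-mono Y⊆⋃G w (Y⊆IY w Yw))
    , (λ w w∈⋁G → IY⊆Y w (I₁C₂-mono ⋃G⊆Y w w∈⋁G))

  ≐-⋃-c-singletons : ∀ {Y : Subset X ℓ} → IsRO F Y →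
                     Y ≐ ⋃ F {I = Σ X Y} (λ p → c F (⟦_⟧ F (proj₁ p)))
  ≐-⋃-c-singletons YRO =
      (λ w Yw → (w , Yw) , ∈-c-singleton w)
    , (λ w ((x , Yx) , w∈cx) → c-singleton-⊆ YRO Yx w w∈cx)

  ≐-⋃-nominals-below : ∀ {Y : Subset X ℓ} → IsRO F Y →
                       Y ≐ ⋃ F {I = Σ (Subset X (suc ℓ)) (λ Z → InNom F Z × (Z ⊆ Y))} proj₁
  ≐-⋃-nominals-below YRO =
      (λ w Yw → (c F (⟦_⟧ F w) , nominal w , c-singleton-⊆ YRO Yw) , ∈-c-singleton w)
    , (λ w ((Z , _ , Z⊆Y) , Zw) → Z⊆Y w Zw)
    where
    nominal : ∀ x → InNom F (c F (⟦_⟧ F x))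
    nominal x = x , (λ _ h → h) , (λ _ h → h)

mainTheorem2 : {ℓ : Level} (M : ModalFMFrame ℓ) (Y : Subset (ModalFMFrame.X M) ℓ) →
    IsRO (ModalFMFrame.frame M) Y →
    (Y ≐ ⋁RO (ModalFMFrame.frame M) {I = Σ (ModalFMFrame.X M) Y} (λ p → c (ModalFMFrame.frame M) (⟦_⟧ (ModalFMFrame.frame M) (proj₁ p))))
    × (Y ≐ ⋁RO (ModalFMFrame.frame M) {I = Σ (Subset (ModalFMFrame.X M) (suc ℓ)) (λ Z → InNom (ModalFMFrame.frame M) Z × (Z ⊆ Y))} proj₁)
mainTheorem2 M Y YRO =
    IsRO-≐-⋁RO F YRO (≐-⋃-c-singletons F YRO)
  , IsRO-≐-⋁RO F YRO (≐-⋃-nominals-below F YRO)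
  where
  F = ModalFMFrame.frame M
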